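{- Let $G$ be a connected graph of order $n$. (1) If $n\ge 5$ and ${\rm diam}(G)\ge 3$, then $\eta_p(G)\le n-2$. (2) If $n\ge 7$ and ${\rm diam}(G)\ge 4$, then $\eta_p(G)\le n-3$.
   Context: Graphs are finite, simple, undirected and connected; ${\rm diam}(G)$ is the diameter. For $v\in V(G)$, $S\subseteq V(G)$: $d(v,S)=\min\{d(v,w):w\in S\}$. For a partition $\Pi=\{S_1,\dots,S_k\}$ of $V(G)$, $r(u|\Pi)=(d(u,S_1),\dots,d(u,S_k))$; $\Pi$ is resolving if $r(u|\Pi)\ne r(v|\Pi)$ for all distinct $u,v$, and dominating if each vertex $v$ has $d(v,S_j)=1$ for some $j$. $\eta_p(G)$ is the minimum cardinality of a partition that is both resolving and dominating. -}

module Defs where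

open import Data.Nat using (ℕ; zero; suc; _≤_)
open import Data.Fin using (Fin)
open import Data.Bool using (Bool; true; false)
open import Data.Product using (Σ; ∃; _×_; _,_)
open import Relation.Binary.PropositionalEquality using (_≡_; _≢_)

record Graph (n : ℕ) : Set where
  field
    adj   : Fin n → Fin n → Bool
    sym   : ∀ u v → adj u v ≡ adj v u
    irrefl : ∀ u → adj u u ≡ false

open Graph public

Adj : ∀ {n} → Graph n → Fin n → Fin n → Set
Adj G u v = adj G u v ≡ true

data Walk {n : ℕ} (G : Graph n) : Fin n → Fin n → ℕ → Set where
  here : ∀ {u} → Walk G u u 0
  step : ∀ {u w v k} → Adj G u w → Walk G w v k → Walk G u v (suc k)

Connected : ∀ {n} → Graph n → Set
Connected G = ∀ u v → ∃ λ k → Walk G u v k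

Dist : ∀ {n} → Graph n → Fin n → Fin n → ℕ → Set
Dist G u v k = Walk G u v k × (∀ m → Walk G u v m → k ≤ m)

DiamAtLeast : ∀ {n} → Graph n → ℕ → Set
DiamAtLeast G d = ∃ λ u → ∃ λ v → ∃ λ k → Dist G u v k × d ≤ k

-- A partition of V(G) into k classes S_0,…,S_{k-1}: c assigns each vertex its
-- class, and every class is nonempty.
IsPartition : ∀ {n k} → (Fin n → Fin k) → Set
IsPartition {n} {k} c = ∀ (j : Fin k) → ∃ λ (w : Fin n) → c w ≡ j

DistToClass : ∀ {n k} → Graph n → (Fin n → Fin k) → Fin n → Fin k → ℕ → Set
DistToClass G c u j m =
  (∃ λ w → c w ≡ j × Walk G u w m) ×
  (∀ w → c w ≡ j → ∀ m' → Walk G u w m' → m ≤ m')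

Resolving : ∀ {n k} → Graph n → (Fin n → Fin k) → Set
Resolving G c = ∀ u v → u ≢ v →
  ∃ λ j → ∃ λ a → ∃ λ b → DistToClass G c u j a × DistToClass G c v j b × a ≢ b

Dominating : ∀ {n k} → Graph n → (Fin n → Fin k) → Set
Dominating G c = ∀ v → ∃ λ j → DistToClass G c v j 1

-- η_p(G) ≤ b : there is a resolving dominating partition of cardinality ≤ b
-- (equivalent to the minimum such cardinality being ≤ b).
EtaPAtMost : ∀ {n} → Graph n → ℕ → Set
EtaPAtMost {n} G b = ∃ λ k → k ≤ b × Σ (Fin n → Fin k) λ c →
  IsPartition c × Resolving G c × Dominating G c

module Submission where

-- Take a geodesic a₀a₁…a_d (d = 3, resp. 4) realising the diameter and a vertex
-- y off it, which exists because n is large.  Starting from the partition into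
-- singletons, merge a few vertices : {a₁, a₂} and {a₃, y} in part (1); {a₂, a₃},
-- {a₁, a₄} and {y, t} with t ∈ {a₀, a₁} in part (2).  Vertices in different classes are
-- always distinguished (their own class is at distance 0 from one of them only), so
-- the partition is resolving as soon as each merged pair is separated by some class,
-- which the distances along the geodesic provide; it is dominating as soon as every
-- vertex has a neighbour outside its class.  Which merges work depends on the
-- neighbours of y on the geodesic, possibly after traversing the geodesic backwards.

open import Defs hiding (sym)
open import Data.Nat using (ℕ; zero; suc; _≤_; _<_; _∸_; _+_; z≤n; s≤s; NonZero; ≢-nonZero⁻¹)
open import Data.Nat.Properties
  using ( +-comm; +-suc; +-∸-assoc; m∸[m∸n]≡n; m+n∸n≡m; m+[n∸m]≡n; ∸-monoˡ-≤; m≤n+o⇒m∸n≤o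
        ; ≤-refl; ≤-reflexive; ≤-trans; <-≤-trans; <⇒≢; <⇒≱; n≤0⇒n≡0; suc-injective
        ; m≤m+n; n≤1+n; module ≤-Reasoning)
open import Data.Fin using (Fin; zero; suc; #_; toℕ; opposite; inject≤; punchOut; punchIn)
open import Data.Fin.Properties
  using ( punchOut-injective; punchInᵢ≢i; punchOut-punchIn; punchOut-cong
        ; toℕ≤pred[n]; toℕ-inject≤; opposite-prop; any?; injective⇒≤)
  renaming (_≟_ to _≟ᶠ_)
open import Data.Bool using (true; false) renaming (_≟_ to _≟ᵇ_)
open import Data.List using (List; []; _∷_; length)
open import Data.List.Membership.Propositional using (_∈_)
open import Data.List.Relation.Unary.All as All using (All; []; _∷_)
open import Data.List.Relation.Unary.Any using (here; there)
open import Data.Product using (∃; _×_; _,_; proj₁; proj₂)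
open import Data.Product.Properties using (,-injectiveˡ; ,-injectiveʳ)
open import Data.Sum using (_⊎_; inj₁; inj₂; [_,_]′)
open import Data.Empty using (⊥; ⊥-elim)
open import Function using (_∘_)
open import Relation.Nullary using (Dec; yes; no; ¬?)
open import Relation.Nullary.Decidable using (_×-dec_)
open import Relation.Binary.PropositionalEquality

InPair : {A : Set} → A → A → A → Set
InPair i j z = z ≡ i ⊎ z ≡ j

Merged : {A : Set} → A → A → A → A → Set
Merged i j a b = a ≡ b ⊎ (InPair i j a × InPair i j b)

mergeIndex : ∀ {k} (i j : Fin (suc k)) → i ≢ j → Fin (suc k) → Fin k
mergeIndex i j i≢j z with i ≟ᶠ z
... | yes _   = punchOut i≢j
... | no i≢z  = punchOut i≢z

mergeIndex-pair : ∀ {k} (i j : Fin (suc k)) (i≢j : i ≢ j) z →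
  InPair i j z → mergeIndex i j i≢j z ≡ punchOut i≢j
mergeIndex-pair i j i≢j z z∈ij with i ≟ᶠ z
... | yes _ = refl
mergeIndex-pair i j i≢j z (inj₁ z≡i) | no i≢z = ⊥-elim (i≢z (sym z≡i))
mergeIndex-pair i j i≢j z (inj₂ z≡j) | no i≢z = punchOut-cong i z≡j

mergeIndex-merged← : ∀ {k} (i j : Fin (suc k)) (i≢j : i ≢ j) a b →
  Merged i j a b → mergeIndex i j i≢j a ≡ mergeIndex i j i≢j b
mergeIndex-merged← i j i≢j a b (inj₁ refl) = refl
mergeIndex-merged← i j i≢j a b (inj₂ (a∈ij , b∈ij)) =
  trans (mergeIndex-pair i j i≢j a a∈ij) (sym (mergeIndex-pair i j i≢j b b∈ij))

mergeIndex-merged→ : ∀ {k} (i j : Fin (suc k)) (i≢j : i ≢ j) a b →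
  mergeIndex i j i≢j a ≡ mergeIndex i j i≢j b → Merged i j a b
mergeIndex-merged→ i j i≢j a b eq with i ≟ᶠ a | i ≟ᶠ b
... | yes i≡a | yes i≡b = inj₂ (inj₁ (sym i≡a) , inj₁ (sym i≡b))
... | yes i≡a | no i≢b  = inj₂ (inj₁ (sym i≡a) , inj₂ (sym (punchOut-injective i≢j i≢b eq)))
... | no i≢a  | yes i≡b = inj₂ (inj₂ (punchOut-injective i≢a i≢j eq) , inj₁ (sym i≡b))
... | no i≢a  | no i≢b  = inj₁ (punchOut-injective i≢a i≢b eq)

mergeIndex-surjective : ∀ {k} (i j : Fin (suc k)) (i≢j : i ≢ j) t →
  mergeIndex i j i≢j (punchIn i t) ≡ t
mergeIndex-surjective i j i≢j t with i ≟ᶠ punchIn i t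
... | yes i≡ = ⊥-elim (punchInᵢ≢i i t (sym i≡))
... | no _   = trans (punchOut-cong i refl) (punchOut-punchIn i)

redirect : ∀ {n} → Fin n → Fin n → Fin n → Fin n
redirect s t x with x ≟ᶠ s
... | yes _ = t
... | no _  = x

redirect-cases : ∀ {n} (s t x : Fin n) →
  (x ≡ s × redirect s t x ≡ t) ⊎ (x ≢ s × redirect s t x ≡ x)
redirect-cases s t x with x ≟ᶠ s
... | yes x≡s = inj₁ (x≡s , refl)
... | no x≢s  = inj₂ (x≢s , refl)

redirect-other : ∀ {n} (s t x : Fin n) → x ≢ s → redirect s t x ≡ x
redirect-other s t x x≢s with redirect-cases s t x
... | inj₁ (x≡s , _) = ⊥-elim (x≢s x≡s)
... | inj₂ (_ , eq)  = eq

redirect-merged→ : ∀ {n} (s t a b : Fin n) → redirect s t a ≡ redirect s t b → Merged s t a b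
redirect-merged→ s t a b eq with redirect-cases s t a | redirect-cases s t b
... | inj₁ (a≡s , _)   | inj₁ (b≡s , _)   = inj₂ (inj₁ a≡s , inj₁ b≡s)
... | inj₁ (a≡s , ra)  | inj₂ (_ , rb)    = inj₂ (inj₁ a≡s , inj₂ (trans (sym rb) (trans (sym eq) ra)))
... | inj₂ (_ , ra)    | inj₁ (b≡s , rb)  = inj₂ (inj₂ (trans (sym ra) (trans eq rb)) , inj₁ b≡s)
... | inj₂ (_ , ra)    | inj₂ (_ , rb)    = inj₁ (trans (sym ra) (trans eq rb))

redirect-merged← : ∀ {n} (s t a b : Fin n) → s ≢ t → Merged s t a b → redirect s t a ≡ redirect s t b
redirect-merged← s t a b s≢t (inj₁ refl) = refl
redirect-merged← s t a b s≢t (inj₂ (a∈st , b∈st)) = trans (toT a a∈st) (sym (toT b b∈st))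
  where
  toT : ∀ x → InPair s t x → redirect s t x ≡ t
  toT x (inj₁ x≡s) with redirect-cases s t x
  ... | inj₁ (_ , r)     = r
  ... | inj₂ (x≢s , _)   = ⊥-elim (x≢s x≡s)
  toT x (inj₂ refl) = redirect-other s x x (λ x≡s → s≢t (sym x≡s))

record FibrePartition (n k : ℕ) (ρ : Fin n → Fin n) : Set where
  field
    class       : Fin n → Fin k
    isPartition : IsPartition class
    sameRep     : ∀ x z → class x ≡ class z → ρ x ≡ ρ z
    sameClass   : ∀ x z → ρ x ≡ ρ z → class x ≡ class z

open FibrePartition public

discrete : ∀ n → FibrePartition n n (λ x → x)
discrete n = record
  { class = λ x → x ; isPartition = λ j → j , refl
  ; sameRep = λ _ _ e → e ; sameClass = λ _ _ e → e }

mergeFibres : ∀ {n k ρ} → FibrePartition n (suc k) ρ → (s t : Fin n) →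
  ρ s ≡ s → ρ t ≡ t → s ≢ t → FibrePartition n k (λ x → redirect s t (ρ x))
mergeFibres {n} {k} {ρ} F s t ρs ρt s≢t = record
  { class = class′ ; isPartition = onto ; sameRep = sameRep′ ; sameClass = sameClass′ }
  where
  C : Fin n → Fin (suc k)
  C = class F
  Cs≢Ct : C s ≢ C t
  Cs≢Ct e = s≢t (trans (sym ρs) (trans (sameRep F s t e) ρt))
  class′ : Fin n → Fin k
  class′ x = mergeIndex (C s) (C t) Cs≢Ct (C x)
  onto : IsPartition class′
  onto j with isPartition F (punchIn (C s) j)
  ... | x , Cx = x , trans (cong (mergeIndex (C s) (C t) Cs≢Ct) Cx) (mergeIndex-surjective (C s) (C t) Cs≢Ct j)
  toRep : ∀ x → InPair (C s) (C t) (C x) → InPair s t (ρ x)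
  toRep x (inj₁ e) = inj₁ (trans (sameRep F x s e) ρs)
  toRep x (inj₂ e) = inj₂ (trans (sameRep F x t e) ρt)
  toClass : ∀ x → InPair s t (ρ x) → InPair (C s) (C t) (C x)
  toClass x (inj₁ e) = inj₁ (sameClass F x s (trans e (sym ρs)))
  toClass x (inj₂ e) = inj₂ (sameClass F x t (trans e (sym ρt)))
  sameRep′ : ∀ x z → class′ x ≡ class′ z → redirect s t (ρ x) ≡ redirect s t (ρ z)
  sameRep′ x z e with mergeIndex-merged→ (C s) (C t) Cs≢Ct (C x) (C z) e
  ... | inj₁ Cx≡Cz = cong (redirect s t) (sameRep F x z Cx≡Cz)
  ... | inj₂ (x∈ , z∈) = redirect-merged← s t (ρ x) (ρ z) s≢t (inj₂ (toRep x x∈ , toRep z z∈))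
  sameClass′ : ∀ x z → redirect s t (ρ x) ≡ redirect s t (ρ z) → class′ x ≡ class′ z
  sameClass′ x z e with redirect-merged→ s t (ρ x) (ρ z) e
  ... | inj₁ ρx≡ρz = cong (mergeIndex (C s) (C t) Cs≢Ct) (sameClass F x z ρx≡ρz)
  ... | inj₂ (x∈ , z∈) =
    mergeIndex-merged← (C s) (C t) Cs≢Ct (C x) (C z) (inj₂ (toClass x x∈ , toClass z z∈))

-- A merge table lists pairs (s , t) : the class of s is merged into that of t.
Table : ℕ → Set
Table n = List (Fin n × Fin n)

-- Representative map of a table: apply the redirections, last entry first.
follow : ∀ {n} → Table n → Fin n → Fin n
follow [] x = x
follow ((s , t) ∷ rs) x = redirect s t (follow rs x)

NotSource NotTarget : ∀ {n} → Fin n → Table n → Set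
NotSource x rs = All (λ e → x ≢ proj₁ e) rs
NotTarget x rs = All (λ e → x ≢ proj₂ e) rs

-- A table is valid if, entry by entry, the source s is untouched by the later
-- entries and the target t is not redirected by them; then s and t are still
-- distinct representatives when they are merged.
data Valid {n} : Table n → Set where
  []    : Valid []
  entry : ∀ {s t rs} → s ≢ t → NotSource s rs → NotTarget s rs → NotSource t rs →
          Valid rs → Valid ((s , t) ∷ rs)

follow-fixed : ∀ {n} (rs : Table n) {x} → NotSource x rs → follow rs x ≡ x
follow-fixed [] [] = refl
follow-fixed ((s , t) ∷ rs) {x} (x≢s ∷ ns) =
  trans (cong (redirect s t) (follow-fixed rs ns)) (redirect-other s t x x≢s)

follow-source : ∀ {n} {rs : Table n} {s t} → Valid rs → (s , t) ∈ rs → follow rs s ≡ t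
follow-source {rs = (s , t) ∷ rs} (entry _ s-ns _ _ _) (here refl)
  with redirect-cases s t (follow rs s)
... | inj₁ (_ , r)      = r
... | inj₂ (s′≢s , _)   = ⊥-elim (s′≢s (follow-fixed rs s-ns))
follow-source {rs = (s , t) ∷ rs} (entry _ _ s-nt _ v) (there s′t′∈) =
  trans (cong (redirect s t) (follow-source v s′t′∈))
        (redirect-other s t _ (λ t′≡s → All.lookup s-nt s′t′∈ (sym t′≡s)))

follow-preimage : ∀ {n} {rs : Table n} {x z} → Valid rs → follow rs x ≡ z → x ≡ z ⊎ (x , z) ∈ rs
follow-preimage {rs = []} [] eq = inj₁ eq
follow-preimage {rs = (s , t) ∷ rs} {x} (entry _ _ s-nt _ v) eq
  with redirect-cases s t (follow rs x)
... | inj₂ (_ , r) with follow-preimage v (trans (sym r) eq)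
...   | inj₁ x≡z  = inj₁ x≡z
...   | inj₂ xz∈  = inj₂ (there xz∈)
follow-preimage {rs = (s , t) ∷ rs} {x} (entry _ _ s-nt _ v) refl | inj₁ (fx≡s , r)
  with follow-preimage v fx≡s
... | inj₁ refl = inj₂ (here (cong (x ,_) r))
... | inj₂ xs∈  = ⊥-elim (All.lookup s-nt xs∈ refl)

-- How two distinct vertices can end up with the same representative.
data Linked {n} (rs : Table n) (u v : Fin n) : Set where
  forward  : (u , v) ∈ rs → Linked rs u v
  backward : (v , u) ∈ rs → Linked rs u v
  siblings : ∀ {t} → (u , t) ∈ rs → (v , t) ∈ rs → Linked rs u v

follow-collision : ∀ {n} {rs : Table n} {u v} → Valid rs → u ≢ v →
  follow rs u ≡ follow rs v → Linked rs u v
follow-collision {u = u} {v} valid u≢v eq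
  with follow-preimage {x = u} valid eq | follow-preimage {x = v} valid refl
... | inj₁ u≡fv | inj₁ v≡fv = ⊥-elim (u≢v (trans u≡fv (sym v≡fv)))
... | inj₁ u≡fv | inj₂ vfv∈ = backward (subst (λ w → (v , w) ∈ _) (sym u≡fv) vfv∈)
... | inj₂ ufv∈ | inj₁ v≡fv = forward (subst (λ w → (u , w) ∈ _) (sym v≡fv) ufv∈)
... | inj₂ ut∈  | inj₂ vt∈  = siblings ut∈ vt∈

tablePartition : ∀ {n} (rs : Table n) → Valid rs → ∀ k m → m ≡ length rs + k →
  FibrePartition n m (λ x → x) → FibrePartition n k (follow rs)
tablePartition [] [] k m refl F = F
tablePartition ((s , t) ∷ rs) (entry s≢t s-ns _ t-ns v) k m m≡ F =
  mergeFibres (tablePartition rs v (suc k) m (trans m≡ (sym (+-suc (length rs) k))) F)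
              s t (follow-fixed rs s-ns) (follow-fixed rs t-ns) s≢t

leastWitness : {P : ℕ → Set} → (∀ m → Dec (P m)) → ∀ m₀ → P m₀ →
  ∃ λ m → P m × (∀ m′ → P m′ → m ≤ m′)
leastWitness P? m₀ p with P? 0
... | yes p₀ = 0 , p₀ , λ _ _ → z≤n
leastWitness P? zero p     | no ¬p₀ = ⊥-elim (¬p₀ p)
leastWitness P? (suc m₀) p | no ¬p₀ with leastWitness (P? ∘ suc) m₀ p
... | m , pm , least =
  suc m , pm , λ { zero p₀ → ⊥-elim (¬p₀ p₀) ; (suc m′) pm′ → s≤s (least m′ pm′) }

module Walks {n : ℕ} (G : Graph n) where

  adj-sym : ∀ {u v} → Adj G u v → Adj G v u
  adj-sym {u} {v} e = trans (Graph.sym G v u) e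

  adj-irrefl : ∀ {u v} → Adj G u v → u ≢ v
  adj-irrefl {u} e refl with trans (sym e) (Graph.irrefl G u)
  ... | ()

  _++_ : ∀ {a b c p q} → Walk G a b p → Walk G b c q → Walk G a c (p + q)
  here     ++ w′ = w′
  step e w ++ w′ = step e (w ++ w′)

  reverse : ∀ {a b p} → Walk G a b p → Walk G b a p
  reverse here = here
  reverse {p = suc p} (step e w) =
    subst (Walk G _ _) (+-comm p 1) (reverse w ++ step (adj-sym e) here)

  nonadj-sym : ∀ {u v} → adj G u v ≡ false → adj G v u ≡ false
  nonadj-sym {u} {v} u≁v = trans (Graph.sym G v u) u≁v

  nonAdjacent-far : ∀ {u v} → u ≢ v → adj G u v ≡ false → ∀ {m} → Walk G u v m → 2 ≤ m
  nonAdjacent-far u≢v _ here = ⊥-elim (u≢v refl)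
  nonAdjacent-far _ u≁v (step e here) with trans (sym e) u≁v
  ... | ()
  nonAdjacent-far _ _ (step _ (step _ _)) = s≤s (s≤s z≤n)

  neighbour : Connected G → ∀ u v → u ≢ v → ∃ λ w → Adj G u w
  neighbour conn u v u≢v with conn u v
  ... | _ , here = ⊥-elim (u≢v refl)
  ... | _ , step {w = w} e _ = w , e

  Reach : (Fin n → Set) → Fin n → ℕ → Set
  Reach P u m = ∃ λ w → P w × Walk G u w m

  reach? : {P : Fin n → Set} → (∀ w → Dec (P w)) → ∀ u m → Dec (Reach P u m)
  reach? P? u zero with P? u
  ... | yes p = yes (u , p , here)
  ... | no ¬p = no λ { (_ , pw , here) → ¬p pw }
  reach? P? u (suc m) with any? (λ w → (adj G u w ≟ᵇ true) ×-dec reach? P? w m)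
  ... | yes (w , e , x , px , wk) = yes (x , px , step e wk)
  ... | no ¬r = no λ { (x , px , step {w = w} e wk) → ¬r (w , e , x , px , wk) }

  distToClass : Connected G → ∀ {k} (c : Fin n → Fin k) u j → (∃ λ w → c w ≡ j) →
    ∃ λ m → DistToClass G c u j m
  distToClass conn c u j (w₀ , cw₀) with conn u w₀
  ... | k₀ , walk with leastWitness (reach? (λ w → c w ≟ᶠ j) u) k₀ (w₀ , cw₀ , walk)
  ... | m , reach , least = m , reach , λ w cw m′ walk′ → least m′ (w , cw , walk′)

  Distinguished : ∀ {k} → (Fin n → Fin k) → Fin n → Fin n → Set
  Distinguished c u v = ∃ λ j → ∃ λ a → ∃ λ b →
    DistToClass G c u j a × DistToClass G c v j b × a ≢ b

  distinguished-sym : ∀ {k} {c : Fin n → Fin k} {u v} → Distinguished c u v → Distinguished c v u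
  distinguished-sym (j , a , b , du , dv , a≢b) = j , b , a , dv , du , λ e → a≢b (sym e)

  separatedBy : Connected G → ∀ {k} (c : Fin n → Fin k) → IsPartition c → ∀ u v r α →
    Walk G u r α → (∀ x → c x ≡ c r → ∀ m → Walk G v x m → suc α ≤ m) → Distinguished c u v
  separatedBy conn c part u v r α u→r far
    with distToClass conn c u (c r) (part (c r)) | distToClass conn c v (c r) (part (c r))
  ... | a , du | b , dv@((x , cx , v→x) , _) =
    c r , a , b , du , dv , <⇒≢ (<-≤-trans (s≤s a≤α) (far x cx b v→x))
    where
    a≤α : a ≤ α
    a≤α = proj₂ du r refl α u→r

  -- Vertices in different classes are distinguished by the class of the first.
  differentClasses : Connected G → ∀ {k} (c : Fin n → Fin k) → IsPartition c → ∀ u v →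
    c u ≢ c v → Distinguished c u v
  differentClasses conn c part u v cu≢cv = separatedBy conn c part u v u 0 here far
    where
    far : ∀ x → c x ≡ c u → ∀ m → Walk G v x m → 1 ≤ m
    far x cx m here = ⊥-elim (cu≢cv (sym cx))
    far x cx m (step _ _) = s≤s z≤n

  dominatedBy : ∀ {k} (c : Fin n → Fin k) v w → Adj G v w → c w ≢ c v →
    ∃ λ j → DistToClass G c v j 1
  dominatedBy c v w e cw≢cv = c w , (w , refl , step e here) , near
    where
    near : ∀ x → c x ≡ c w → ∀ m → Walk G v x m → 1 ≤ m
    near x cx m here = ⊥-elim (cw≢cv (sym cx))
    near x cx m (step _ _) = s≤s z≤n

  resolvingDominatingIf : Connected G → ∀ {k} (c : Fin n → Fin k) → IsPartition c →
    (∀ u v → u ≢ v → c u ≡ c v → Distinguished c u v) →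
    (∀ v → ∃ λ w → Adj G v w × c w ≢ c v) →
    Resolving G c × Dominating G c
  resolvingDominatingIf conn c part classmates neighbours = resolving , dominating
    where
    resolving : Resolving G c
    resolving u v u≢v with c u ≟ᶠ c v
    ... | yes cu≡cv = classmates u v u≢v cu≡cv
    ... | no cu≢cv  = differentClasses conn c part u v cu≢cv
    dominating : Dominating G c
    dominating v with neighbours v
    ... | w , e , cw≢cv = dominatedBy c v w e cw≢cv

∸-reverse : ∀ {ℓ} i j → j ≤ ℓ → j ∸ i ≤ (ℓ ∸ i) ∸ (ℓ ∸ j)
∸-reverse {ℓ} zero j j≤ℓ = ≤-reflexive (sym (m∸[m∸n]≡n j≤ℓ))
∸-reverse (suc i) zero _ = z≤n
∸-reverse (suc i) (suc j) (s≤s j≤ℓ) = ∸-reverse i j j≤ℓ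

suc-∸ : ∀ {ℓ i j} → suc i ≡ j → j ≤ ℓ → suc (ℓ ∸ j) ≡ ℓ ∸ i
suc-∸ refl j≤ℓ = sym (+-∸-assoc 1 j≤ℓ)

detour : ∀ i j k m → k ≤ (i + m) + (k ∸ j) → j ≤ k → j ∸ i ≤ m
detour i j k m k≤ j≤k = m≤n+o⇒m∸n≤o j i (begin
  j                              ≡⟨ sym (m∸[m∸n]≡n j≤k) ⟩
  k ∸ (k ∸ j)                    ≤⟨ ∸-monoˡ-≤ (k ∸ j) k≤ ⟩
  (i + m) + (k ∸ j) ∸ (k ∸ j)    ≡⟨ m+n∸n≡m (i + m) (k ∸ j) ⟩
  i + m                          ∎)
  where open ≤-Reasoning

missedVertex : ∀ {n t} → t < n → (s : Fin t → Fin n) → ∃ λ y → ∀ i → y ≢ s i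
missedVertex {n} {t} t<n s with any? (λ y → ¬? (any? (λ i → y ≟ᶠ s i)))
... | yes (y , ¬hit) = y , λ i y≡ → ¬hit (i , y≡)
... | no ¬missed = ⊥-elim (<⇒≱ t<n (injective⇒≤ {f = index} index-injective))
  where
  hit : ∀ y → ∃ λ i → y ≡ s i
  hit y with any? (λ i → y ≟ᶠ s i)
  ... | yes h = h
  ... | no ¬h = ⊥-elim (¬missed (y , ¬h))
  index : Fin n → Fin t
  index y = proj₁ (hit y)
  index-injective : ∀ {x y} → index x ≡ index y → x ≡ y
  index-injective {x} {y} eq = trans (proj₂ (hit x)) (trans (cong s eq) (sym (proj₂ (hit y))))

module Geodesics {n : ℕ} (G : Graph n) where
  open Walks G

  -- A geodesic path v₀ v₁ … v_ℓ : consecutive vertices are adjacent and every walk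
  -- from v_i to v_j has length at least j − i, i.e. d(v_i, v_j) = |j − i|.
  record Geodesic (ℓ : ℕ) : Set where
    field
      vertex : Fin (suc ℓ) → Fin n
      edge   : ∀ i j → suc (toℕ i) ≡ toℕ j → Adj G (vertex i) (vertex j)
      far    : ∀ i j {m} → Walk G (vertex i) (vertex j) m → toℕ j ∸ toℕ i ≤ m

    far⁻ : ∀ i j {m} → Walk G (vertex j) (vertex i) m → toℕ j ∸ toℕ i ≤ m
    far⁻ i j w = far i j (reverse w)

    distinct : ∀ i j .{{_ : NonZero (toℕ j ∸ toℕ i)}} → vertex i ≢ vertex j
    distinct i j {{nz}} vi≡vj =
      ≢-nonZero⁻¹ _ {{nz}} (n≤0⇒n≡0 (far i j (subst (λ x → Walk G (vertex i) x 0) vi≡vj here)))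

  open Geodesic public

  vertexAt : ∀ {u v k} → Walk G u v k → Fin (suc k) → Fin n
  vertexAt {u = u} _ zero = u
  vertexAt (step _ w) (suc i) = vertexAt w i

  prefix : ∀ {u v k} (w : Walk G u v k) i → Walk G u (vertexAt w i) (toℕ i)
  prefix w zero = here
  prefix (step e w) (suc i) = step e (prefix w i)

  suffix : ∀ {u v k} (w : Walk G u v k) i → Walk G (vertexAt w i) v (k ∸ toℕ i)
  suffix w zero = w
  suffix (step e w) (suc i) = suffix w i

  edgeAt : ∀ {u v k} (w : Walk G u v k) i j → suc (toℕ i) ≡ toℕ j →
    Adj G (vertexAt w i) (vertexAt w j)
  edgeAt (step e w) zero (suc zero) _ = e
  edgeAt (step e w) (suc i) (suc j) eq = edgeAt w i j (suc-injective eq)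

  -- Every shortest walk is a geodesic : a shortcut between two of its vertices
  -- would give a shorter walk between its ends.
  shortestWalk-geodesic : ∀ {u v k} → Dist G u v k → Geodesic k
  shortestWalk-geodesic {k = k} (w , shortest) = record
    { vertex = vertexAt w ; edge = edgeAt w ; far = far′ }
    where
    far′ : ∀ i j {m} → Walk G (vertexAt w i) (vertexAt w j) m → toℕ j ∸ toℕ i ≤ m
    far′ i j {m} shortcut = detour (toℕ i) (toℕ j) k m
      (shortest _ ((prefix w i ++ shortcut) ++ suffix w j)) (toℕ≤pred[n] j)

  shorten : ∀ {ℓ k} → ℓ ≤ k → Geodesic k → Geodesic ℓ
  shorten {ℓ} {k} ℓ≤k P = record
    { vertex = λ i → vertex P (cut i)
    ; edge   = λ i j eq → edge P (cut i) (cut j)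
                 (trans (cong suc (toℕ-cut i)) (trans eq (sym (toℕ-cut j))))
    ; far    = λ i j w → subst₂ (λ a b → b ∸ a ≤ _) (toℕ-cut i) (toℕ-cut j) (far P (cut i) (cut j) w) }
    where
    cut : Fin (suc ℓ) → Fin (suc k)
    cut i = inject≤ i (s≤s ℓ≤k)
    toℕ-cut : ∀ i → toℕ (cut i) ≡ toℕ i
    toℕ-cut i = toℕ-inject≤ i (s≤s ℓ≤k)

  backwards : ∀ {ℓ} → Geodesic ℓ → Geodesic ℓ
  backwards {ℓ} P = record
    { vertex = λ i → vertex P (opposite i)
    ; edge   = λ i j eq → adj-sym (edge P (opposite j) (opposite i) (step-back i j eq))
    ; far    = λ i j w → ≤-trans (∸-reverse (toℕ i) (toℕ j) (toℕ≤pred[n] j))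
                                 (far-back i j (far⁻ P (opposite j) (opposite i) w)) }
    where
    step-back : ∀ i j → suc (toℕ i) ≡ toℕ j → suc (toℕ (opposite j)) ≡ toℕ (opposite i)
    step-back i j eq rewrite opposite-prop i | opposite-prop j = suc-∸ eq (toℕ≤pred[n] j)
    far-back : ∀ i j {m} → toℕ (opposite i) ∸ toℕ (opposite j) ≤ m →
      (ℓ ∸ toℕ i) ∸ (ℓ ∸ toℕ j) ≤ m
    far-back i j le rewrite opposite-prop i | opposite-prop j = le

  diameterGeodesic : ∀ {d} → DiamAtLeast G d → Geodesic d
  diameterGeodesic (_ , _ , _ , dist , d≤k) = shorten d≤k (shortestWalk-geodesic dist)

module TableClasses {n : ℕ} (G : Graph n) (conn : Connected G)
  (rs : Table n) (valid : Valid rs) {k : ℕ} (F : FibrePartition n k (follow rs)) where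
  open Walks G

  C : Fin n → Fin k
  C = class F

  classmate : ∀ {x z t} → C x ≡ C z → follow rs z ≡ t → x ≡ t ⊎ (x , t) ∈ rs
  classmate {x} {z} cx fz = follow-preimage valid (trans (sameRep F x z cx) fz)

  classesDiffer : ∀ {x z p q} → follow rs x ≡ p → follow rs z ≡ q → p ≢ q → C x ≢ C z
  classesDiffer {x} {z} fx fz p≢q cx = p≢q (trans (sym fx) (trans (sameRep F x z cx) fz))

  singletonFar : ∀ {v r β} → follow rs r ≡ r → NotTarget r rs →
    (∀ m → Walk G v r m → β ≤ m) → ∀ x → C x ≡ C r → ∀ m → Walk G v x m → β ≤ m
  singletonFar fr untargeted far x cx with classmate cx fr
  ... | inj₁ refl = far
  ... | inj₂ xr∈  = ⊥-elim (All.lookup untargeted xr∈ refl)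

  separated : ∀ u v r α → Walk G u r α →
    (∀ x → C x ≡ C r → ∀ m → Walk G v x m → suc α ≤ m) → Distinguished C u v
  separated = separatedBy conn C (isPartition F)

  -- A vertex occurring nowhere in the table is a singleton class, so any neighbour
  -- (which exists since v has some other vertex u) lies in another class.
  untouchedDominated : ∀ v u → v ≢ u → NotSource v rs → NotTarget v rs →
    ∃ λ w → Adj G v w × C w ≢ C v
  untouchedDominated v u v≢u unsourced untargeted with neighbour conn v u v≢u
  ... | w , vw = w , vw , separate
    where
    separate : C w ≢ C v
    separate cw with classmate cw (follow-fixed rs unsourced)
    ... | inj₁ w≡v = adj-irrefl vw (sym w≡v)
    ... | inj₂ wv∈ = All.lookup untargeted wv∈ refl

  tableCriterion : (∀ u v → u ≢ v → Linked rs u v → Distinguished C u v) →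
    (∀ v → ∃ λ w → Adj G v w × C w ≢ C v) → Resolving G C × Dominating G C
  tableCriterion linked = resolvingDominatingIf conn C (isPartition F)
    (λ u v u≢v cu → linked u v u≢v (follow-collision valid u≢v (sameRep F u v cu)))

etaFromTable : ∀ {n} (G : Graph n) (rs : Table n) → Valid rs → length rs ≤ n →
  (∀ {k} (F : FibrePartition n k (follow rs)) → Resolving G (class F) × Dominating G (class F)) →
  EtaPAtMost G (n ∸ length rs)
etaFromTable {n} G rs valid rs≤n resolvingDominating =
  n ∸ length rs , ≤-refl , class F , isPartition F , resolvingDominating F
  where
  F : FibrePartition n (n ∸ length rs) (follow rs)
  F = tablePartition rs valid (n ∸ length rs) n (sym (m+[n∸m]≡n rs≤n)) (discrete n)

module Bounds {n : ℕ} (G : Graph n) (conn : Connected G) where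
  open Walks G
  open Geodesics G

  -- On a geodesic a₀a₁a₂a₃ and a vertex y off it, the partition with
  -- classes {a₁, a₂}, {a₃, y} and singletons is resolving and dominating, provided y
  -- is adjacent to a₁ or to neither a₁ nor a₂, and y has a neighbour w ≠ a₃.
  module ThreePath (P : Geodesic 3) (y : Fin n) (outside : ∀ i → y ≢ vertex P i)
    (y-near : Adj G y (vertex P (# 1)) ⊎
              (adj G y (vertex P (# 1)) ≡ false × adj G y (vertex P (# 2)) ≡ false))
    (w : Fin n) (yw : Adj G y w) (w≢a₃ : w ≢ vertex P (# 3)) where

    a₀ a₁ a₂ a₃ : Fin n
    a₀ = vertex P (# 0)
    a₁ = vertex P (# 1)
    a₂ = vertex P (# 2)
    a₃ = vertex P (# 3)

    e₀₁ : Adj G a₀ a₁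
    e₀₁ = edge P (# 0) (# 1) refl
    e₂₃ : Adj G a₂ a₃
    e₂₃ = edge P (# 2) (# 3) refl

    table : Table n
    table = (a₂ , a₁) ∷ (y , a₃) ∷ []

    valid : Valid table
    valid =
      entry (≢-sym (distinct P (# 1) (# 2)))
            (≢-sym (outside (# 2)) ∷ []) (distinct P (# 2) (# 3) ∷ []) (≢-sym (outside (# 1)) ∷ [])
      (entry (outside (# 3)) [] [] [] [])

    module _ {k} (F : FibrePartition n k (follow table)) where
      open TableClasses G conn table valid F

      rep₀ : follow table a₀ ≡ a₀
      rep₀ = follow-fixed table (distinct P (# 0) (# 2) ∷ ≢-sym (outside (# 0)) ∷ [])
      rep₁ : follow table a₁ ≡ a₁
      rep₁ = follow-fixed table (distinct P (# 1) (# 2) ∷ ≢-sym (outside (# 1)) ∷ [])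
      rep₂ : follow table a₂ ≡ a₁
      rep₂ = follow-source valid (here refl)
      rep₃ : follow table a₃ ≡ a₃
      rep₃ = follow-fixed table (≢-sym (distinct P (# 2) (# 3)) ∷ ≢-sym (outside (# 3)) ∷ [])
      repy : follow table y ≡ a₃
      repy = follow-source valid (there (here refl))

      -- {a₀} is a class of its own.
      a₀-alone : ∀ {v β} → (∀ m → Walk G v a₀ m → β ≤ m) →
        ∀ x → C x ≡ C a₀ → ∀ m → Walk G v x m → β ≤ m
      a₀-alone = singletonFar rep₀ (distinct P (# 0) (# 1) ∷ distinct P (# 0) (# 3) ∷ [])

      -- d(a₁, a₀) = 1 < 2 ≤ d(a₂, a₀).
      a₁a₂ : Distinguished C a₁ a₂
      a₁a₂ = separated a₁ a₂ a₀ 1 (step (adj-sym e₀₁) here) (a₀-alone (λ _ → far⁻ P (# 0) (# 2)))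

      -- If y ~ a₁ then d(y, a₀) ≤ 2 < 3 ≤ d(a₃, a₀);
      -- otherwise d(a₃, {a₁, a₂}) = 1 < 2 ≤ d(y, {a₁, a₂}).
      a₃y : Distinguished C a₃ y
      a₃y = byNeighbourhood y-near
        where
        byNeighbourhood : Adj G y a₁ ⊎ (adj G y a₁ ≡ false × adj G y a₂ ≡ false) →
          Distinguished C a₃ y
        byNeighbourhood (inj₁ y~a₁) = distinguished-sym
          (separated y a₃ a₀ 2 (step y~a₁ (step (adj-sym e₀₁) here))
             (a₀-alone (λ _ → far⁻ P (# 0) (# 3))))
        byNeighbourhood (inj₂ (y≁a₁ , y≁a₂)) = separated a₃ y a₂ 1 (step (adj-sym e₂₃) here) y-far
          where
          y-far : ∀ x → C x ≡ C a₂ → ∀ m → Walk G y x m → 2 ≤ m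
          y-far x cx with classmate cx rep₂
          ... | inj₁ refl             = λ _ → nonAdjacent-far (outside (# 1)) y≁a₁
          ... | inj₂ (here refl)      = λ _ → nonAdjacent-far (outside (# 2)) y≁a₂
          ... | inj₂ (there (here e)) = ⊥-elim (distinct P (# 1) (# 3) (,-injectiveʳ e))

      classmatesDistinguished : ∀ u v → u ≢ v → Linked table u v → Distinguished C u v
      classmatesDistinguished u v u≢v (forward (here refl))          = distinguished-sym a₁a₂
      classmatesDistinguished u v u≢v (forward (there (here refl)))  = distinguished-sym a₃y
      classmatesDistinguished u v u≢v (backward (here refl))         = a₁a₂
      classmatesDistinguished u v u≢v (backward (there (here refl))) = a₃y
      classmatesDistinguished u v u≢v (siblings (here refl) (here refl)) = ⊥-elim (u≢v refl)
      classmatesDistinguished u v u≢v (siblings (here refl) (there (here e))) =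
        ⊥-elim (distinct P (# 1) (# 3) (,-injectiveʳ e))
      classmatesDistinguished u v u≢v (siblings (there (here refl)) (here e)) =
        ⊥-elim (distinct P (# 1) (# 3) (sym (,-injectiveʳ e)))
      classmatesDistinguished u v u≢v (siblings (there (here refl)) (there (here refl))) =
        ⊥-elim (u≢v refl)

      neighbourElsewhere : ∀ v → ∃ λ x → Adj G v x × C x ≢ C v
      neighbourElsewhere v with v ≟ᶠ a₁ | v ≟ᶠ a₂ | v ≟ᶠ a₃ | v ≟ᶠ y
      ... | yes refl | _ | _ | _ =
        a₀ , adj-sym e₀₁ , classesDiffer rep₀ rep₁ (distinct P (# 0) (# 1))
      ... | no _ | yes refl | _ | _ =
        a₃ , e₂₃ , classesDiffer rep₃ rep₂ (≢-sym (distinct P (# 1) (# 3)))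
      ... | no _ | no _ | yes refl | _ =
        a₂ , adj-sym e₂₃ , classesDiffer rep₂ rep₃ (distinct P (# 1) (# 3))
      ... | no _ | no _ | no _ | yes refl = w , yw , w-elsewhere
        where
        w-elsewhere : C w ≢ C y
        w-elsewhere cw with classmate cw repy
        ... | inj₁ w≡a₃             = w≢a₃ w≡a₃
        ... | inj₂ (here e)         = distinct P (# 1) (# 3) (sym (,-injectiveʳ e))
        ... | inj₂ (there (here e)) = adj-irrefl yw (sym (,-injectiveˡ e))
      ... | no v≢a₁ | no v≢a₂ | no v≢a₃ | no v≢y =
        untouchedDominated v a₁ v≢a₁ (v≢a₂ ∷ v≢y ∷ []) (v≢a₁ ∷ v≢a₃ ∷ [])

      resolvingDominating : Resolving G C × Dominating G C
      resolvingDominating = tableCriterion classmatesDistinguished neighbourElsewhere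

    eta : 2 ≤ n → EtaPAtMost G (n ∸ 2)
    eta 2≤n = etaFromTable G table valid 2≤n resolvingDominating

  -- Part (1) : take a geodesic a₀a₁a₂a₃ and a fifth vertex y.  If y ~ a₁ use it as it
  -- is; if y ~ a₂ (but y ≁ a₁) reverse it; otherwise y has a neighbour w, and the
  -- geodesic is reversed exactly when w = a₃.
  part1 : 5 ≤ n → DiamAtLeast G 3 → EtaPAtMost G (n ∸ 2)
  part1 5≤n diam = choose (missedVertex 5≤n (vertex P))
    where
    P : Geodesic 3
    P = diameterGeodesic diam
    2≤n : 2 ≤ n
    2≤n = ≤-trans (m≤m+n 2 3) 5≤n
    choose : (∃ λ y → ∀ i → y ≢ vertex P i) → EtaPAtMost G (n ∸ 2)
    choose (y , outside) with adj G y (vertex P (# 1)) in y~a₁ | adj G y (vertex P (# 2)) in y~a₂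
    ... | true  | _    = ThreePath.eta P y outside (inj₁ y~a₁) _ y~a₁ (distinct P (# 1) (# 3)) 2≤n
    ... | false | true = ThreePath.eta (backwards P) y (outside ∘ opposite) (inj₁ y~a₂) _ y~a₂
                           (≢-sym (distinct P (# 0) (# 2))) 2≤n
    ... | false | false with neighbour conn y (vertex P (# 0)) (outside (# 0))
    ...   | w , yw with w ≟ᶠ vertex P (# 3)
    ...     | yes refl = ThreePath.eta (backwards P) y (outside ∘ opposite) (inj₂ (y~a₂ , y~a₁)) w yw
                           (≢-sym (distinct P (# 0) (# 3))) 2≤n
    ...     | no w≢a₃  = ThreePath.eta P y outside (inj₂ (y~a₁ , y~a₂)) w yw w≢a₃ 2≤n

  -- On a geodesic a₀a₁a₂a₃a₄, a vertex y off it and t ∈ {a₀, a₁}, the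
  -- table merges a₃ into a₂, a₄ into a₁ and y into t.
  module FourPath (P : Geodesic 4) (y : Fin n) (outside : ∀ i → y ≢ vertex P i)
    (t : Fin n) (t-low : t ≡ vertex P (# 0) ⊎ t ≡ vertex P (# 1)) where

    a₀ a₁ a₂ a₃ a₄ : Fin n
    a₀ = vertex P (# 0)
    a₁ = vertex P (# 1)
    a₂ = vertex P (# 2)
    a₃ = vertex P (# 3)
    a₄ = vertex P (# 4)

    e₀₁ : Adj G a₀ a₁
    e₀₁ = edge P (# 0) (# 1) refl
    e₁₂ : Adj G a₁ a₂
    e₁₂ = edge P (# 1) (# 2) refl
    e₃₄ : Adj G a₃ a₄
    e₃₄ = edge P (# 3) (# 4) refl

    t≢ : ∀ {x} → a₀ ≢ x → a₁ ≢ x → t ≢ x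
    t≢ a₀≢x a₁≢x t≡x =
      [ (λ t≡a₀ → a₀≢x (trans (sym t≡a₀) t≡x))
      , (λ t≡a₁ → a₁≢x (trans (sym t≡a₁) t≡x)) ]′ t-low

    t≢a₂ : t ≢ a₂
    t≢a₂ = t≢ (distinct P (# 0) (# 2)) (distinct P (# 1) (# 2))

    table : Table n
    table = (a₃ , a₂) ∷ (a₄ , a₁) ∷ (y , t) ∷ []

    valid : Valid table
    valid =
      entry (≢-sym (distinct P (# 2) (# 3)))
            (distinct P (# 3) (# 4) ∷ ≢-sym (outside (# 3)) ∷ [])
            (≢-sym (distinct P (# 1) (# 3))
              ∷ ≢-sym (t≢ (distinct P (# 0) (# 3)) (distinct P (# 1) (# 3))) ∷ [])
            (distinct P (# 2) (# 4) ∷ ≢-sym (outside (# 2)) ∷ [])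
      (entry (≢-sym (distinct P (# 1) (# 4)))
             (≢-sym (outside (# 4)) ∷ [])
             (≢-sym (t≢ (distinct P (# 0) (# 4)) (distinct P (# 1) (# 4))) ∷ [])
             (≢-sym (outside (# 1)) ∷ [])
      (entry (≢-sym (t≢ (≢-sym (outside (# 0))) (≢-sym (outside (# 1))))) [] [] [] []))

    module Classes {k} (F : FibrePartition n k (follow table)) where
      open TableClasses G conn table valid F public

      rep₀ : follow table a₀ ≡ a₀
      rep₀ = follow-fixed table (distinct P (# 0) (# 3) ∷ distinct P (# 0) (# 4) ∷ ≢-sym (outside (# 0)) ∷ [])
      rep₁ : follow table a₁ ≡ a₁
      rep₁ = follow-fixed table (distinct P (# 1) (# 3) ∷ distinct P (# 1) (# 4) ∷ ≢-sym (outside (# 1)) ∷ [])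
      rep₂ : follow table a₂ ≡ a₂
      rep₂ = follow-fixed table (distinct P (# 2) (# 3) ∷ distinct P (# 2) (# 4) ∷ ≢-sym (outside (# 2)) ∷ [])
      rep₃ : follow table a₃ ≡ a₂
      rep₃ = follow-source valid (here refl)
      rep₄ : follow table a₄ ≡ a₁
      rep₄ = follow-source valid (there (here refl))
      repy : follow table y ≡ t
      repy = follow-source valid (there (there (here refl)))

      class₂-far : ∀ {z v β} → follow table z ≡ a₂ → (∀ m → Walk G v a₂ m → β ≤ m) →
        (∀ m → Walk G v a₃ m → β ≤ m) → ∀ x → C x ≡ C z → ∀ m → Walk G v x m → β ≤ m
      class₂-far fz far₂ far₃ x cx with classmate cx fz
      ... | inj₁ refl                     = far₂
      ... | inj₂ (here refl)              = far₃
      ... | inj₂ (there (here e))         = ⊥-elim (distinct P (# 1) (# 2) (sym (,-injectiveʳ e)))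
      ... | inj₂ (there (there (here e))) = ⊥-elim (t≢a₂ (sym (,-injectiveʳ e)))

      -- Lower bounds for walks into the class of a₀, which contains y exactly when t = a₀.
      class₀-far : ∀ {z v β} → follow table z ≡ a₀ → (∀ m → Walk G v a₀ m → β ≤ m) →
        (a₀ ≡ t → ∀ m → Walk G v y m → β ≤ m) →
        ∀ x → C x ≡ C z → ∀ m → Walk G v x m → β ≤ m
      class₀-far {v = v} {β} fz far₀ far-y x cx with classmate cx fz
      ... | inj₁ refl             = far₀
      ... | inj₂ (here e)         = ⊥-elim (distinct P (# 0) (# 2) (,-injectiveʳ e))
      ... | inj₂ (there (here e)) = ⊥-elim (distinct P (# 0) (# 1) (,-injectiveʳ e))
      ... | inj₂ (there (there (here e))) =
        subst (λ x → ∀ m → Walk G v x m → β ≤ m) (sym (,-injectiveˡ e)) (far-y (,-injectiveʳ e))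

      -- The merged pairs are (a₂, a₃), (a₁, a₄), (t, y) and, when t = a₁, also (a₄, y).
      classmatesDistinguished : Distinguished C a₂ a₃ → Distinguished C a₁ a₄ →
        Distinguished C t y → (a₁ ≡ t → Distinguished C a₄ y) →
        ∀ u v → u ≢ v → Linked table u v → Distinguished C u v
      classmatesDistinguished a₂a₃ a₁a₄ ty a₄y = linked
        where
        linked : ∀ u v → u ≢ v → Linked table u v → Distinguished C u v
        linked u v u≢v (forward (here refl))                  = distinguished-sym a₂a₃
        linked u v u≢v (forward (there (here refl)))          = distinguished-sym a₁a₄
        linked u v u≢v (forward (there (there (here refl))))  = distinguished-sym ty
        linked u v u≢v (backward (here refl))                 = a₂a₃
        linked u v u≢v (backward (there (here refl)))         = a₁a₄
        linked u v u≢v (backward (there (there (here refl)))) = ty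
        linked u v u≢v (siblings (here refl) (here refl)) = ⊥-elim (u≢v refl)
        linked u v u≢v (siblings (here refl) (there (here e))) =
          ⊥-elim (distinct P (# 1) (# 2) (sym (,-injectiveʳ e)))
        linked u v u≢v (siblings (here refl) (there (there (here e)))) =
          ⊥-elim (t≢a₂ (sym (,-injectiveʳ e)))
        linked u v u≢v (siblings (there (here refl)) (here e)) =
          ⊥-elim (distinct P (# 1) (# 2) (,-injectiveʳ e))
        linked u v u≢v (siblings (there (here refl)) (there (here refl))) = ⊥-elim (u≢v refl)
        linked u v u≢v (siblings (there (here refl)) (there (there (here e)))) =
          subst (Distinguished C a₄) (sym (,-injectiveˡ e)) (a₄y (,-injectiveʳ e))
        linked u v u≢v (siblings (there (there (here refl))) (here e)) =
          ⊥-elim (t≢a₂ (,-injectiveʳ e))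
        linked u v u≢v (siblings (there (there (here refl))) (there (here e))) =
          subst (Distinguished C y) (sym (,-injectiveˡ e)) (distinguished-sym (a₄y (sym (,-injectiveʳ e))))
        linked u v u≢v (siblings (there (there (here refl))) (there (there (here refl)))) =
          ⊥-elim (u≢v refl)

      neighbourElsewhere : (∃ λ x → Adj G y x × C x ≢ C y) → ∀ v → ∃ λ x → Adj G v x × C x ≢ C v
      neighbourElsewhere y-dominated v
        with v ≟ᶠ a₀ | v ≟ᶠ a₁ | v ≟ᶠ a₂ | v ≟ᶠ a₃ | v ≟ᶠ a₄ | v ≟ᶠ y
      ... | yes refl | _ | _ | _ | _ | _ =
        a₁ , e₀₁ , classesDiffer rep₁ rep₀ (≢-sym (distinct P (# 0) (# 1)))
      ... | no _ | yes refl | _ | _ | _ | _ =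
        a₀ , adj-sym e₀₁ , classesDiffer rep₀ rep₁ (distinct P (# 0) (# 1))
      ... | no _ | no _ | yes refl | _ | _ | _ =
        a₁ , adj-sym e₁₂ , classesDiffer rep₁ rep₂ (distinct P (# 1) (# 2))
      ... | no _ | no _ | no _ | yes refl | _ | _ =
        a₄ , e₃₄ , classesDiffer rep₄ rep₃ (distinct P (# 1) (# 2))
      ... | no _ | no _ | no _ | no _ | yes refl | _ =
        a₃ , adj-sym e₃₄ , classesDiffer rep₃ rep₄ (≢-sym (distinct P (# 1) (# 2)))
      ... | no _ | no _ | no _ | no _ | no _ | yes refl = y-dominated
      ... | no v≢a₀ | no v≢a₁ | no v≢a₂ | no v≢a₃ | no v≢a₄ | no v≢y =
        untouchedDominated v a₀ v≢a₀ (v≢a₃ ∷ v≢a₄ ∷ v≢y ∷ [])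
          (v≢a₂ ∷ v≢a₁ ∷ ≢-sym (t≢ (≢-sym v≢a₀) (≢-sym v≢a₁)) ∷ [])

  -- t = a₁ : classes {a₂, a₃}, {a₁, a₄, y}.  Needs y to avoid both a₂ and a₃, or to be
  -- adjacent to a₂ but not to a₀; and a neighbour w of y outside {a₁, a₄}.
  module MergeIntoA₁ (P : Geodesic 4) (y : Fin n) (outside : ∀ i → y ≢ vertex P i)
    (y-near : (adj G y (vertex P (# 2)) ≡ false × adj G y (vertex P (# 3)) ≡ false) ⊎
              (Adj G y (vertex P (# 2)) × adj G y (vertex P (# 0)) ≡ false))
    (w : Fin n) (yw : Adj G y w) (w≢a₁ : w ≢ vertex P (# 1)) (w≢a₄ : w ≢ vertex P (# 4)) where
    open FourPath P y outside (vertex P (# 1)) (inj₂ refl)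

    module _ {k} (F : FibrePartition n k (follow table)) where
      open Classes F

      -- Here y is not in the class of a₀.
      y-apart : ∀ {v β} → a₀ ≡ a₁ → ∀ m → Walk G v y m → β ≤ m
      y-apart a₀≡a₁ = ⊥-elim (distinct P (# 0) (# 1) a₀≡a₁)

      -- d(a₂, a₀) = 2 < 3 ≤ d(a₃, a₀).
      a₂a₃ : Distinguished C a₂ a₃
      a₂a₃ = separated a₂ a₃ a₀ 2 (step (adj-sym e₁₂) (step (adj-sym e₀₁) here))
               (class₀-far rep₀ (λ _ → far⁻ P (# 0) (# 3)) y-apart)

      -- d(a₁, a₀) = 1 < 2 ≤ 4 ≤ d(a₄, a₀).
      a₁a₄ : Distinguished C a₁ a₄
      a₁a₄ = separated a₁ a₄ a₀ 1 (step (adj-sym e₀₁) here)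
               (class₀-far rep₀ (λ _ w → ≤-trans (m≤m+n 2 2) (far⁻ P (# 0) (# 4) w)) y-apart)

      -- Either d(·, {a₂, a₃}) = 1 for a₁ and a₄ but ≥ 2 for y; or y ~ a₂, y ≁ a₀ and
      -- d(a₁, a₀) = 1 < 2 ≤ d(y, a₀) ≤ 3 < 4 ≤ d(a₄, a₀).
      a₁y×a₄y : Distinguished C a₁ y × Distinguished C a₄ y
      a₁y×a₄y = byNeighbourhood y-near
        where
        byNeighbourhood :
          (adj G y a₂ ≡ false × adj G y a₃ ≡ false) ⊎ (Adj G y a₂ × adj G y a₀ ≡ false) →
          Distinguished C a₁ y × Distinguished C a₄ y
        byNeighbourhood (inj₁ (y≁a₂ , y≁a₃)) =
          separated a₁ y a₂ 1 (step e₁₂ here) (y-far rep₂) ,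
          separated a₄ y a₃ 1 (step (adj-sym e₃₄) here) (y-far rep₃)
          where
          y-far : ∀ {z} → follow table z ≡ a₂ → ∀ x → C x ≡ C z → ∀ m → Walk G y x m → 2 ≤ m
          y-far fz = class₂-far fz (λ _ → nonAdjacent-far (outside (# 2)) y≁a₂)
                                   (λ _ → nonAdjacent-far (outside (# 3)) y≁a₃)
        byNeighbourhood (inj₂ (y~a₂ , y≁a₀)) =
          separated a₁ y a₀ 1 (step (adj-sym e₀₁) here)
            (class₀-far rep₀ (λ _ → nonAdjacent-far (outside (# 0)) y≁a₀) y-apart) ,
          distinguished-sym (separated y a₄ a₀ 3 (step y~a₂ (step (adj-sym e₁₂) (step (adj-sym e₀₁) here)))
            (class₀-far rep₀ (λ _ → far⁻ P (# 0) (# 4)) y-apart))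

      w-elsewhere : C w ≢ C y
      w-elsewhere cw with classmate cw repy
      ... | inj₁ w≡a₁                     = w≢a₁ w≡a₁
      ... | inj₂ (here e)                 = distinct P (# 1) (# 2) (,-injectiveʳ e)
      ... | inj₂ (there (here e))         = w≢a₄ (,-injectiveˡ e)
      ... | inj₂ (there (there (here e))) = adj-irrefl yw (sym (,-injectiveˡ e))

      resolvingDominating : Resolving G C × Dominating G C
      resolvingDominating = tableCriterion
        (classmatesDistinguished a₂a₃ a₁a₄ (proj₁ a₁y×a₄y) (λ _ → proj₂ a₁y×a₄y))
        (neighbourElsewhere (w , yw , w-elsewhere))

    eta : 3 ≤ n → EtaPAtMost G (n ∸ 3)
    eta 3≤n = etaFromTable G table valid 3≤n resolvingDominating

  -- t = a₀ : classes {a₂, a₃}, {a₁, a₄}, {a₀, y}.  Needs y ~ a₃, y ≁ a₂ and y ≁ a₄.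
  module MergeIntoA₀ (P : Geodesic 4) (y : Fin n) (outside : ∀ i → y ≢ vertex P i)
    (y~a₃ : Adj G y (vertex P (# 3))) (y≁a₂ : adj G y (vertex P (# 2)) ≡ false)
    (y≁a₄ : adj G y (vertex P (# 4)) ≡ false) where
    open FourPath P y outside (vertex P (# 0)) (inj₁ refl)

    module _ {k} (F : FibrePartition n k (follow table)) where
      open Classes F

      -- d(a₃, {a₀, y}) = 1 < 2 ≤ d(a₂, {a₀, y}).
      a₂a₃ : Distinguished C a₂ a₃
      a₂a₃ = distinguished-sym (separated a₃ a₂ y 1 (step (adj-sym y~a₃) here)
               (class₀-far repy (λ _ → far⁻ P (# 0) (# 2))
                 (λ _ _ → nonAdjacent-far (≢-sym (outside (# 2))) (nonadj-sym y≁a₂))))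

      -- d(a₁, {a₀, y}) = 1 < 2 ≤ d(a₄, {a₀, y}).
      a₁a₄ : Distinguished C a₁ a₄
      a₁a₄ = separated a₁ a₄ a₀ 1 (step (adj-sym e₀₁) here)
               (class₀-far rep₀ (λ _ w → ≤-trans (m≤m+n 2 2) (far⁻ P (# 0) (# 4) w))
                 (λ _ _ → nonAdjacent-far (≢-sym (outside (# 4))) (nonadj-sym y≁a₄)))

      -- d(y, {a₂, a₃}) = 1 < 2 ≤ d(a₀, {a₂, a₃}).
      a₀y : Distinguished C a₀ y
      a₀y = distinguished-sym (separated y a₀ a₃ 1 (step y~a₃ here)
              (class₂-far rep₃ (λ _ → far P (# 0) (# 2))
                               (λ _ w → ≤-trans (m≤m+n 2 1) (far P (# 0) (# 3) w))))

      resolvingDominating : Resolving G C × Dominating G C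
      resolvingDominating = tableCriterion
        (classmatesDistinguished a₂a₃ a₁a₄ a₀y
          (λ a₁≡a₀ → ⊥-elim (distinct P (# 0) (# 1) (sym a₁≡a₀))))
        (neighbourElsewhere (a₃ , y~a₃ , classesDiffer rep₃ repy (≢-sym (distinct P (# 0) (# 2)))))

    eta : 3 ≤ n → EtaPAtMost G (n ∸ 3)
    eta 3≤n = etaFromTable G table valid 3≤n resolvingDominating

  noCommonNeighbour : ∀ {ℓ} (P : Geodesic ℓ) i j {x m} → Adj G x (vertex P i) → Adj G x (vertex P j) →
    3 + m ≤ toℕ j ∸ toℕ i → ⊥
  noCommonNeighbour P i j xi xj gap with ≤-trans gap (far P i j (step (adj-sym xi) (step xj here)))
  ... | s≤s (s≤s ())

  -- Part (2) : take a geodesic a₀…a₄ and a sixth vertex y; according to the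
  -- neighbours of y on the geodesic, orient it and apply MergeIntoA₁ or MergeIntoA₀.
  part2 : 7 ≤ n → DiamAtLeast G 4 → EtaPAtMost G (n ∸ 3)
  part2 7≤n diam = choose (missedVertex (≤-trans (n≤1+n 6) 7≤n) (vertex P))
    where
    P Q : Geodesic 4
    P = diameterGeodesic diam
    Q = backwards P
    3≤n : 3 ≤ n
    3≤n = ≤-trans (m≤m+n 3 4) 7≤n
    choose : (∃ λ y → ∀ i → y ≢ vertex P i) → EtaPAtMost G (n ∸ 3)
    choose (y , outside) with adj G y (vertex P (# 2)) in y~a₂
    ... | true with adj G y (vertex P (# 0)) in y~a₀
    ...   | false = MergeIntoA₁.eta P y outside (inj₂ (y~a₂ , y~a₀)) _ y~a₂
                      (≢-sym (distinct P (# 1) (# 2))) (distinct P (# 2) (# 4)) 3≤n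
    ...   | true with adj G y (vertex P (# 4)) in y~a₄
    ...     | true  = ⊥-elim (noCommonNeighbour P (# 0) (# 4) {m = 1} y~a₀ y~a₄ ≤-refl)
    ...     | false = MergeIntoA₁.eta Q y (outside ∘ opposite) (inj₂ (y~a₂ , y~a₄)) _ y~a₂
                        (distinct P (# 2) (# 3)) (≢-sym (distinct P (# 0) (# 2))) 3≤n
    choose (y , outside) | false with adj G y (vertex P (# 3)) in y~a₃
    ... | true with adj G y (vertex P (# 4)) in y~a₄
    ...   | false = MergeIntoA₀.eta P y outside y~a₃ y~a₂ y~a₄ 3≤n
    ...   | true with adj G y (vertex P (# 1)) in y~a₁
    ...     | true  = ⊥-elim (noCommonNeighbour P (# 1) (# 4) {m = 0} y~a₁ y~a₄ ≤-refl)
    ...     | false = MergeIntoA₁.eta Q y (outside ∘ opposite) (inj₁ (y~a₂ , y~a₁)) _ y~a₄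
                        (≢-sym (distinct P (# 3) (# 4))) (≢-sym (distinct P (# 0) (# 4))) 3≤n
    choose (y , outside) | false | false with adj G y (vertex P (# 1)) in y~a₁
    ... | true with adj G y (vertex P (# 0)) in y~a₀
    ...   | false = MergeIntoA₀.eta Q y (outside ∘ opposite) y~a₁ y~a₂ y~a₀ 3≤n
    ...   | true  = MergeIntoA₁.eta P y outside (inj₁ (y~a₂ , y~a₃)) _ y~a₀
                      (distinct P (# 0) (# 1)) (distinct P (# 0) (# 4)) 3≤n
    choose (y , outside) | false | false | false with neighbour conn y (vertex P (# 0)) (outside (# 0))
    ... | w , yw with w ≟ᶠ vertex P (# 4)
    ...   | yes refl = MergeIntoA₁.eta Q y (outside ∘ opposite) (inj₁ (y~a₂ , y~a₁)) w yw
                         (≢-sym (distinct P (# 3) (# 4))) (≢-sym (distinct P (# 0) (# 4))) 3≤n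
    ...   | no w≢a₄  = MergeIntoA₁.eta P y outside (inj₁ (y~a₂ , y~a₃)) w yw w≢a₁ w≢a₄ 3≤n
      where
      w≢a₁ : w ≢ vertex P (# 1)
      w≢a₁ refl with trans (sym yw) y~a₁
      ... | ()

mainTheorem19 : (n : ℕ) (G : Graph n) → Connected G →
    ((5 ≤ n → DiamAtLeast G 3 → EtaPAtMost G (n ∸ 2)) ×
     (7 ≤ n → DiamAtLeast G 4 → EtaPAtMost G (n ∸ 3)))
mainTheorem19 n G conn = Bounds.part1 G conn , Bounds.part2 G conn
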